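{- Let $({\cal G},{\cal D},\{{\cal D}_1,\ldots,{\cal D}_n\})$ be a minimal decomposition of a closed triangulated surface ${\cal T}$. Then every triangle of ${\cal G}$ intersects the boundary $\partial{\cal G}$.
   Context: A closed triangulated surface is a finite simplicial complex whose underlying space is a connected compact surface without boundary. The valence of a vertex is the number of triangles containing it; ${\rm mv}({\cal T})$ is the maximal valence. A decomposition of ${\cal T}$ is a triple $({\cal G},{\cal D},\{{\cal D}_1,\ldots,{\cal D}_n\})$, $n\geq0$, of subcomplexes of ${\cal T}$ with ${\cal D},{\cal D}_1,\ldots,{\cal D}_n$ triangulated discs, the interior of ${\cal D}$ containing a vertex of valence ${\rm mv}({\cal T})$, ${\cal G}\cup{\cal D}\cup{\cal D}_1\cup\dots\cup{\cal D}_n={\cal T}$, and the intersection of any two of these subcomplexes empty or a triangulated circle. ${\cal G}$ is the genus-surface. A decomposition is minimal if the number of triangles of ${\cal G}$ is minimal among all decompositions of ${\cal T}$. -}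

module Defs where

-- A simplex is a nonempty, strictly
-- increasing list of vertices (canonical form of a finite vertex set),
-- so "face of" is the sublist relation and equality of simplices is ≡.

open import Data.Nat using (ℕ; zero; suc; _+_; _<_; _≤_; _⊔_; _≟_)
open import Data.Fin using (Fin)
open import Data.List using (List; []; _∷_; length; filter; map; foldr)
open import Data.List.Properties using (≡-dec)
open import Data.List.Relation.Unary.All using (All)
open import Data.List.Relation.Unary.Any using (Any)
open import Data.List.Relation.Unary.Unique.Propositional using (Unique)
open import Data.List.Relation.Unary.Linked using (Linked)
open import Data.List.Membership.Propositional using (_∈_)
open import Data.List.Membership.DecPropositional (≡-dec _≟_) using (_∈?_)
open import Data.List.Relation.Binary.Sublist.DecPropositional _≟_ using (_⊆_; _⊆?_)
open import Data.Product using (Σ; ∃; ∃-syntax; _×_; _,_)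
open import Data.Sum using (_⊎_)
open import Relation.Nullary using (¬_; _×-dec_)
open import Relation.Binary.PropositionalEquality using (_≡_; _≢_)
open import Relation.Binary.Construct.Closure.ReflexiveTransitive using (Star)

Simplex : Set
Simplex = List ℕ

Complex : Set
Complex = List Simplex

IsSimplex : Simplex → Set
IsSimplex s = Linked _<_ s × 1 ≤ length s

record IsComplex (K : Complex) : Set where
  field
    simplices  : All IsSimplex K
    noDup      : Unique K
    faceClosed : ∀ {s t} → s ∈ K → t ⊆ s → 1 ≤ length t → t ∈ K

IsVertex : Complex → ℕ → Set
IsVertex K v = (v ∷ []) ∈ K

ofSize : ℕ → Complex → Complex
ofSize k K = filter (λ t → length t ≟ k) K

triangles : Complex → Complex
triangles = ofSize 3

edges : Complex → Complex
edges = ofSize 2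

vertices : Complex → Complex
vertices = ofSize 1

cofaceCount : ℕ → Complex → Simplex → ℕ
cofaceCount k K s = length (filter (λ t → s ⊆? t) (ofSize k K))

#triangles : Complex → ℕ
#triangles K = length (triangles K)

Adj : Complex → ℕ → ℕ → Set
Adj K a b = a ≢ b × ∃[ t ] (t ∈ K × length t ≡ 2 × a ∈ t × b ∈ t)

Connected : Complex → Set
Connected K = ∀ u w → IsVertex K u → IsVertex K w → Star (Adj K) u w

LinkAdj : Complex → ℕ → ℕ → ℕ → Set
LinkAdj K v a b =
  a ≢ b × v ≢ a × v ≢ b × ∃[ t ] (t ∈ K × length t ≡ 3 × v ∈ t × a ∈ t × b ∈ t)

LinkConnected : Complex → ℕ → Set
LinkConnected K v = ∀ a b → Adj K v a → Adj K v b → Star (LinkAdj K v) a b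

record Pure2 (K : Complex) : Set where
  field
    dimLe2   : All (λ s → length s ≤ 2 + 1) K
    inTriangle : ∀ {s} → s ∈ K → ∃[ t ] (t ∈ K × length t ≡ 3 × s ⊆ t)

-- closed triangulated surface: finite connected pure 2-dimensional
-- complex, every edge in exactly two triangles, every vertex link
-- connected (hence a circle)
record ClosedSurface (T : Complex) : Set where
  field
    complex   : IsComplex T
    nonempty  : T ≢ []
    pure      : Pure2 T
    connected : Connected T
    edgeTwo   : ∀ {e} → e ∈ T → length e ≡ 2 → cofaceCount 3 T e ≡ 2
    linkConn  : ∀ v → IsVertex T v → LinkConnected T v

record Circle (C : Complex) : Set where
  field
    complex   : IsComplex C
    nonempty  : C ≢ []
    dimLe1    : All (λ s → length s ≤ 2) C
    connected : Connected C
    degTwo    : ∀ v → IsVertex C v → cofaceCount 2 C (v ∷ []) ≡ 2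

BoundaryEdge : Complex → Simplex → Set
BoundaryEdge K e = e ∈ K × length e ≡ 2 × cofaceCount 3 K e ≡ 1

BoundaryVertex : Complex → ℕ → Set
BoundaryVertex K v = ∃[ e ] (BoundaryEdge K e × v ∈ e)

InteriorVertex : Complex → ℕ → Set
InteriorVertex K v = IsVertex K v × ¬ BoundaryVertex K v

-- triangulated disc: connected pure 2-complex which is a surface with
-- boundary (every edge in one or two triangles, vertex links connected,
-- so each link is a path or a circle), whose boundary is a single
-- nonempty connected curve, and with Euler characteristic 1
-- (by the classification of compact surfaces this is exactly a disc)
record Disc (D : Complex) : Set where
  field
    complex    : IsComplex D
    nonempty   : D ≢ []
    pure       : Pure2 D
    connected  : Connected D
    edgeOneTwo : ∀ {e} → e ∈ D → length e ≡ 2 →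
                 cofaceCount 3 D e ≡ 1 ⊎ cofaceCount 3 D e ≡ 2
    linkConn   : ∀ v → IsVertex D v → LinkConnected D v
    hasBoundary : ∃[ v ] BoundaryVertex D v
    boundaryConnected : ∀ u w → BoundaryVertex D u → BoundaryVertex D w →
                        Star (λ a b → a ≢ b × ∃[ e ] (BoundaryEdge D e × a ∈ e × b ∈ e)) u w
    euler      : length (vertices D) + length (triangles D) ≡ length (edges D) + 1

record Subcomplex (L T : Complex) : Set where
  field
    complex : IsComplex L
    sub     : ∀ {s} → s ∈ L → s ∈ T

_∩_ : Complex → Complex → Complex
A ∩ B = filter (λ s → s ∈? B) A

EmptyOrCircle : Complex → Set
EmptyOrCircle C = C ≡ [] ⊎ Circle C

valence : Complex → ℕ → ℕ
valence T v = cofaceCount 3 T (v ∷ [])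

mv : Complex → ℕ
mv T = foldr _⊔_ 0 (map (cofaceCount 3 T) (vertices T))

record Decomposition (T : Complex) : Set where
  field
    G  : Complex
    D  : Complex
    n  : ℕ
    Ds : Fin n → Complex
    G-sub  : Subcomplex G T
    D-sub  : Subcomplex D T
    Ds-sub : ∀ i → Subcomplex (Ds i) T
    D-disc  : Disc D
    Ds-disc : ∀ i → Disc (Ds i)
    D-maxVertex : ∃[ v ] (InteriorVertex D v × valence T v ≡ mv T)
    cover : ∀ {s} → s ∈ T → s ∈ G ⊎ s ∈ D ⊎ ∃[ i ] (s ∈ Ds i)
    GD   : EmptyOrCircle (G ∩ D)
    GDi  : ∀ i → EmptyOrCircle (G ∩ Ds i)
    DDi  : ∀ i → EmptyOrCircle (D ∩ Ds i)
    DiDj : ∀ i j → i ≢ j → EmptyOrCircle (Ds i ∩ Ds j)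

MinimalDecomposition : (T : Complex) → Decomposition T → Set
MinimalDecomposition T d =
  ∀ (d' : Decomposition T) → #triangles (Decomposition.G d) ≤ #triangles (Decomposition.G d')

MeetsBoundary : Complex → Simplex → Set
MeetsBoundary K t = ∃[ v ] (v ∈ t × BoundaryVertex K v)

module Submission where

-- Suppose no vertex of a triangle t of G lies on ∂G, and let v be a vertex of t.  No edge of G at
-- v is then a boundary edge of G; as every edge of T lies in exactly two triangles, crossing an
-- edge at v from a triangle of G leads to a triangle of G again, and walking around the connected
-- link of v shows that every triangle of T at v lies in G.  A piece D or Dᵢ meets G in at most a
-- circle, so it contains no triangle at v, hence no vertex of t at all.  Deleting t from G and
-- adding its closure as a new disc, which meets G ∖ t in the circle ∂t, therefore gives a
-- decomposition whose genus-surface has one triangle fewer, contradicting minimality.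

open import Data.Nat using (ℕ; suc; _<_; _≤_; _≟_; z≤n; s≤s; s≤s⁻¹)
open import Data.Nat.Properties
  using ( ≤-antisym; ≤-refl; ≤-trans; <-trans; <-irrefl; <⇒≢; <⇒≤; <⇒≱; ≰⇒>; _≤?_; <-cmp
        ; module ≤-Reasoning)
open import Data.Fin using (Fin; zero; suc)
open import Data.List using (List; []; _∷_; length; filter)
open import Data.List.Properties
  using ( ≡-dec; length-removeAt′; ∷-injectiveˡ; ∷-injectiveʳ
        ; filter-accept; filter-reject; filter-none)
open import Data.List.Relation.Unary.All as All using ([]; _∷_)
open import Data.List.Relation.Unary.Any as Any using (here; there; index)
open import Data.List.Relation.Unary.AllPairs using ([]; _∷_)
open import Data.List.Relation.Unary.Linked as Linked using (Linked; [-]; _∷_)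
open import Data.List.Relation.Unary.Linked.Properties using (Linked⇒AllPairs)
open import Data.List.Relation.Unary.Unique.Propositional using (Unique)
import Data.List.Relation.Unary.Unique.Propositional.Properties as Unique
open import Data.List.Membership.Propositional using (_∈_; _∉_; _─_; find; lose)
open import Data.List.Membership.Propositional.Properties using (∈-filter⁺; ∈-filter⁻; ∈-length)
open import Data.List.Membership.DecPropositional (≡-dec _≟_) using (_∈?_)
open import Data.List.Membership.DecPropositional _≟_ using () renaming (_∈?_ to _∈ℕ?_)
open import Data.List.Relation.Binary.Subset.Propositional using () renaming (_⊆_ to _⊆ₛ_)
open import Data.List.Relation.Binary.Sublist.DecPropositional _≟_
  using (_⊆_; _⊆?_; []; _∷_; _∷ʳ_; minimum; lookup; to∈; from∈; ⊆-trans)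
open import Data.List.Relation.Binary.Sublist.Heterogeneous.Properties
  using (length-mono-≤; toPointwise)
open import Data.List.Relation.Binary.Pointwise using (Pointwise-≡⇒≡)
open import Data.Product using (∃-syntax; _×_; _,_; proj₁; proj₂)
open import Data.Sum using (_⊎_; inj₁; inj₂)
open import Function using (_∘_; case_of_)
open import Level using (0ℓ)
open import Relation.Nullary using (¬_; Dec; yes; no; contradiction; ¬?; _×-dec_)
open import Relation.Unary using (Pred; Decidable)
open import Relation.Binary using (tri<; tri≈; tri>)
open import Relation.Binary.PropositionalEquality
  using (_≡_; _≢_; refl; sym; trans; cong; subst; ≢-sym)
open import Relation.Binary.Construct.Closure.ReflexiveTransitive using (Star; ε; _◅_)

open import Defs

module _ {A : Set} where

  ∈-─ : ∀ {x y} {ys : List A} (x∈ys : x ∈ ys) → y ∈ ys → y ≢ x → y ∈ ys ─ x∈ys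
  ∈-─ (here refl)  (here refl)  y≢x = contradiction refl y≢x
  ∈-─ (here refl)  (there y∈ys) _   = y∈ys
  ∈-─ (there _)    (here refl)  _   = here refl
  ∈-─ (there x∈ys) (there y∈ys) y≢x = there (∈-─ x∈ys y∈ys y≢x)

  unique⇒length-≤ : ∀ {xs ys : List A} → Unique xs → xs ⊆ₛ ys → length xs ≤ length ys
  unique⇒length-≤ {[]}          _            _     = z≤n
  unique⇒length-≤ {x ∷ xs} {ys} (x∉xs ∷ xs!) xs⊆ys = begin
    suc (length xs)          ≤⟨ s≤s (unique⇒length-≤ xs! xs⊆ys─x) ⟩
    suc (length (ys ─ x∈ys)) ≡⟨ sym (length-removeAt′ ys (index x∈ys)) ⟩
    length ys                ∎
    where
    open ≤-Reasoning
    x∈ys = xs⊆ys (here refl)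
    xs⊆ys─x : xs ⊆ₛ ys ─ x∈ys
    xs⊆ys─x y∈xs = ∈-─ x∈ys (xs⊆ys (there y∈xs)) λ { refl → All.lookup x∉xs y∈xs refl }

  unique⇒length-< : ∀ {xs ys : List A} {y} → Unique xs → xs ⊆ₛ ys → y ∈ ys → y ∉ xs →
                    length xs < length ys
  unique⇒length-< xs! xs⊆ys y∈ys y∉xs =
    unique⇒length-≤ (All.tabulate (λ { z∈xs refl → y∉xs z∈xs }) ∷ xs!)
                    λ { (here refl) → y∈ys ; (there z∈xs) → xs⊆ys z∈xs }

  filter-filter-⇒ : ∀ {P Q : Pred A 0ℓ} (P? : Decidable P) (Q? : Decidable Q) →
                    (∀ {x} → P x → Q x) → ∀ xs → filter P? (filter Q? xs) ≡ filter P? xs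
  filter-filter-⇒ P? Q? P⇒Q [] = refl
  filter-filter-⇒ P? Q? P⇒Q (x ∷ xs) with Q? x
  ... | yes _ with P? x
  ...   | yes _ = cong (x ∷_) (filter-filter-⇒ P? Q? P⇒Q xs)
  ...   | no _  = filter-filter-⇒ P? Q? P⇒Q xs
  filter-filter-⇒ P? Q? P⇒Q (x ∷ xs) | no ¬q with P? x
  ...   | yes p = contradiction (P⇒Q p) ¬q
  ...   | no _  = filter-filter-⇒ P? Q? P⇒Q xs

sorted-head-< : ∀ {x z : ℕ} {xs} → Linked _<_ (x ∷ xs) → z ∈ xs → x < z
sorted-head-< sorted with Linked⇒AllPairs <-trans sorted
... | x<xs ∷ _ = All.lookup x<xs

sorted-head-≤ : ∀ {x z : ℕ} {xs} → Linked _<_ (x ∷ xs) → z ∈ x ∷ xs → x ≤ z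
sorted-head-≤ _      (here refl)  = ≤-refl
sorted-head-≤ sorted (there z∈xs) = <⇒≤ (sorted-head-< sorted z∈xs)

sorted⇒⊆ : ∀ {xs ys : List ℕ} → Linked _<_ xs → Linked _<_ ys → xs ⊆ₛ ys → xs ⊆ ys
sorted⇒⊆ {[]}     {ys}     _ _ _ = minimum ys
sorted⇒⊆ {x ∷ xs} {[]}     _ _ xs⊆ys with xs⊆ys (here refl)
... | ()
sorted⇒⊆ {x ∷ xs} {y ∷ ys} sxs sys xs⊆ys with <-cmp x y
... | tri< x<y _ _ = contradiction (sorted-head-≤ sys (xs⊆ys (here refl))) (<⇒≱ x<y)
... | tri≈ _ refl _ = refl ∷ sorted⇒⊆ (Linked.tail sxs) (Linked.tail sys) λ z∈xs →
  Any.tail (λ { refl → <-irrefl refl (sorted-head-< sxs z∈xs) }) (xs⊆ys (there z∈xs))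
... | tri> _ _ y<x = y ∷ʳ sorted⇒⊆ sxs (Linked.tail sys) λ z∈xs →
  Any.tail (λ { refl → <⇒≱ y<x (sorted-head-≤ sxs z∈xs) }) (xs⊆ys z∈xs)

⊆∧length-≥⇒≡ : ∀ {xs ys : List ℕ} → xs ⊆ ys → length ys ≤ length xs → xs ≡ ys
⊆∧length-≥⇒≡ xs⊆ys ys≤xs =
  Pointwise-≡⇒≡ (toPointwise (≤-antisym (length-mono-≤ xs⊆ys) ys≤xs) xs⊆ys)

record Edge (v x : ℕ) : Set where
  field
    simplex : Simplex
    size    : length simplex ≡ 2
    ∋ˡ      : v ∈ simplex
    ∋ʳ      : x ∈ simplex
    face    : ∀ {s} → Linked _<_ s → v ∈ s → x ∈ s → simplex ⊆ s

edge : ∀ {v x} → v ≢ x → Edge v x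
edge {v} {x} v≢x with <-cmp v x
... | tri< v<x _ _ = record
  { simplex = v ∷ x ∷ [] ; size = refl ; ∋ˡ = here refl ; ∋ʳ = there (here refl)
  ; face    = λ s v∈s x∈s →
      sorted⇒⊆ (v<x ∷ [-]) s λ { (here refl) → v∈s ; (there (here refl)) → x∈s } }
... | tri≈ _ v≡x _ = contradiction v≡x v≢x
... | tri> _ _ x<v = record
  { simplex = x ∷ v ∷ [] ; size = refl ; ∋ˡ = there (here refl) ; ∋ʳ = here refl
  ; face    = λ s v∈s x∈s →
      sorted⇒⊆ (x<v ∷ [-]) s λ { (here refl) → x∈s ; (there (here refl)) → v∈s } }

other-vertex : ∀ {s v} → Linked _<_ s → 2 ≤ length s → v ∈ s → ∃[ x ] (x ∈ s × v ≢ x)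
other-vertex {p ∷ q ∷ _} {v} (p<q ∷ _) _ _ with v ≟ p
... | yes refl = q , there (here refl) , <⇒≢ p<q
... | no v≢p   = p , here refl , v≢p
other-vertex [-] (s≤s ()) _

∈-ofSize⁺ : ∀ {k K s} → s ∈ K → length s ≡ k → s ∈ ofSize k K
∈-ofSize⁺ {k} = ∈-filter⁺ (λ s → length s ≟ k)

∈-ofSize⁻ : ∀ {k K s} → s ∈ ofSize k K → s ∈ K × length s ≡ k
∈-ofSize⁻ {k} = ∈-filter⁻ (λ s → length s ≟ k)

cofaces : ℕ → Complex → Simplex → Complex
cofaces k K s = filter (s ⊆?_) (ofSize k K)

∈-cofaces⁺ : ∀ {k K s u} → u ∈ K → length u ≡ k → s ⊆ u → u ∈ cofaces k K s
∈-cofaces⁺ {k} {K} {s} u∈K |u| s⊆u = ∈-filter⁺ (s ⊆?_) (∈-ofSize⁺ {k} {K} u∈K |u|) s⊆u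

∈-cofaces⁻ : ∀ {k K s u} → u ∈ cofaces k K s → u ∈ K × length u ≡ k × s ⊆ u
∈-cofaces⁻ {k} {K} {s} u∈ with ∈-filter⁻ (s ⊆?_) {xs = ofSize k K} u∈
... | u∈ofSize , s⊆u with ∈-ofSize⁻ {k} {K} u∈ofSize
... | u∈K , |u| = u∈K , |u| , s⊆u

cofaces-unique : ∀ {k K} s → Unique K → Unique (cofaces k K s)
cofaces-unique {k} s K! = Unique.filter⁺ (s ⊆?_) (Unique.filter⁺ (λ u → length u ≟ k) K!)

CofacesIncluded : ℕ → Complex → Complex → Simplex → Set
CofacesIncluded k K L s = ∀ {u} → u ∈ K → length u ≡ k → s ⊆ u → u ∈ L

cofaces-⊆ : ∀ {k K L s} → CofacesIncluded k K L s → cofaces k K s ⊆ₛ cofaces k L s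
cofaces-⊆ {k} {K} {L} K⊆L u∈ with ∈-cofaces⁻ {k} {K} u∈
... | u∈K , |u| , s⊆u = ∈-cofaces⁺ {k} {L} (K⊆L u∈K |u| s⊆u) |u| s⊆u

cofaceCount-≤ : ∀ {k K L s} → Unique K → CofacesIncluded k K L s →
                cofaceCount k K s ≤ cofaceCount k L s
cofaceCount-≤ {k} {K} {L} {s} K! K⊆L =
  unique⇒length-≤ (cofaces-unique s K!) (cofaces-⊆ {k} {K} {L} K⊆L)

cofaceCount-< : ∀ {k K L s u} → Unique K → CofacesIncluded k K L s →
                u ∈ L → length u ≡ k → s ⊆ u → u ∉ K → cofaceCount k K s < cofaceCount k L s
cofaceCount-< {k} {K} {L} {s} K! K⊆L u∈L |u| s⊆u u∉K =
  unique⇒length-< (cofaces-unique s K!) (cofaces-⊆ {k} {K} {L} K⊆L)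
                  (∈-cofaces⁺ {k} {L} u∈L |u| s⊆u) (u∉K ∘ proj₁ ∘ ∈-cofaces⁻ {k} {K})

∈-∩⁺ : ∀ {A B s} → s ∈ A → s ∈ B → s ∈ A ∩ B
∈-∩⁺ {B = B} = ∈-filter⁺ (λ s → s ∈? B)

∈-∩⁻ : ∀ {A B s} → s ∈ A ∩ B → s ∈ A × s ∈ B
∈-∩⁻ {A} {B} = ∈-filter⁻ (λ s → s ∈? B) {xs = A}

disjoint⇒∩≡[] : ∀ {X Y} → (∀ {s} → s ∈ X → s ∉ Y) → X ∩ Y ≡ []
disjoint⇒∩≡[] {Y = Y} X#Y = filter-none (λ s → s ∈? Y) (All.tabulate X#Y)

emptyOrCircle⇒length≤2 : ∀ {K u} → EmptyOrCircle K → u ∈ K → length u ≤ 2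
emptyOrCircle⇒length≤2 (inj₁ refl) ()
emptyOrCircle⇒length≤2 (inj₂ circle) = All.lookup (Circle.dimLe1 circle)

module _ {K : Complex} (K-complex : IsComplex K) where

  sorted : ∀ {s} → s ∈ K → Linked _<_ s
  sorted s∈K = proj₁ (All.lookup (IsComplex.simplices K-complex) s∈K)

  vertex∈ : ∀ {s v} → s ∈ K → v ∈ s → IsVertex K v
  vertex∈ s∈K v∈s = IsComplex.faceClosed K-complex s∈K (from∈ v∈s) (s≤s z≤n)

  edge∈ : ∀ {s v x} → s ∈ K → v ∈ s → x ∈ s → (e : Edge v x) → Edge.simplex e ∈ K
  edge∈ s∈K v∈s x∈s e =
    IsComplex.faceClosed K-complex s∈K (Edge.face e (sorted s∈K) v∈s x∈s)
                         (subst (1 ≤_) (sym (Edge.size e)) (s≤s z≤n))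

  adjacent : ∀ {s v x} → s ∈ K → v ∈ s → x ∈ s → v ≢ x → Adj K v x
  adjacent s∈K v∈s x∈s v≢x =
    v≢x , Edge.simplex e , edge∈ s∈K v∈s x∈s e , Edge.size e , Edge.∋ˡ e , Edge.∋ʳ e
    where e = edge v≢x

module InteriorStar {T} (surface : ClosedSurface T) {G} (G⊆T : Subcomplex G T) where
  open ClosedSurface surface using (edgeTwo; linkConn) renaming (complex to T-complex)
  open Subcomplex G⊆T renaming (complex to G-complex; sub to G⊆ₛT)

  missing-coface⇒BoundaryEdge :
    ∀ {e w u} → e ∈ G → length e ≡ 2 → w ∈ G → length w ≡ 3 → e ⊆ w →
    u ∈ T → length u ≡ 3 → e ⊆ u → u ∉ G → BoundaryEdge G e
  missing-coface⇒BoundaryEdge {e} e∈G |e| w∈G |w| e⊆w u∈T |u| e⊆u u∉G =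
    e∈G , |e| , ≤-antisym (s≤s⁻¹ (subst (cofaceCount 3 G e <_) (edgeTwo (G⊆ₛT e∈G) |e|) G<T))
                          (∈-length (∈-cofaces⁺ {3} {G} w∈G |w| e⊆w))
    where
    G<T : cofaceCount 3 G e < cofaceCount 3 T e
    G<T = cofaceCount-< {3} {G} {T} (IsComplex.noDup G-complex) (λ u∈G _ _ → G⊆ₛT u∈G)
                        u∈T |u| e⊆u u∉G

  GTriangle : ℕ → ℕ → Set
  GTriangle v x = ∃[ w ] (w ∈ G × length w ≡ 3 × v ∈ w × x ∈ w)

  interior-cross : ∀ {v a u} → ¬ BoundaryVertex G v → GTriangle v a → v ≢ a →
                   u ∈ T → length u ≡ 3 → v ∈ u → a ∈ u → u ∈ G
  interior-cross {v} {a} {u} v∉∂G (w , w∈G , |w| , v∈w , a∈w) v≢a u∈T |u| v∈u a∈u with u ∈? G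
  ... | yes u∈G = u∈G
  ... | no u∉G  = contradiction (Edge.simplex e , e-boundary , Edge.∋ˡ e) v∉∂G
    where
    e = edge v≢a
    e-boundary : BoundaryEdge G (Edge.simplex e)
    e-boundary = missing-coface⇒BoundaryEdge (edge∈ G-complex w∈G v∈w a∈w e) (Edge.size e)
      w∈G |w| (Edge.face e (sorted G-complex w∈G) v∈w a∈w)
      u∈T |u| (Edge.face e (sorted T-complex u∈T) v∈u a∈u) u∉G

  link-walk : ∀ {v a x} → ¬ BoundaryVertex G v → Star (LinkAdj T v) a x →
              GTriangle v a → GTriangle v x
  link-walk _ ε w = w
  link-walk v∉∂G ((_ , v≢a , _ , u , u∈T , |u| , v∈u , a∈u , b∈u) ◅ path) w =
    link-walk v∉∂G path (u , interior-cross v∉∂G w v≢a u∈T |u| v∈u a∈u , |u| , v∈u , b∈u)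

  interior⇒star⊆G : ∀ {t v s} → t ∈ G → length t ≡ 3 → v ∈ t → ¬ BoundaryVertex G v →
                    s ∈ T → length s ≡ 3 → v ∈ s → s ∈ G
  interior⇒star⊆G {t} {v} {s} t∈G |t| v∈t v∉∂G s∈T |s| v∈s =
    let (a , a∈t , v≢a) = other-vertex (sorted T-complex t∈T) (two≤ {t} |t|) v∈t
        (x , x∈s , v≢x) = other-vertex (sorted T-complex s∈T) (two≤ {s} |s|) v∈s
        path = linkConn v (vertex∈ T-complex t∈T v∈t) a x
                 (adjacent T-complex t∈T v∈t a∈t v≢a) (adjacent T-complex s∈T v∈s x∈s v≢x)
    in interior-cross v∉∂G (link-walk v∉∂G path (t , t∈G , |t| , v∈t , a∈t)) v≢x s∈T |s| v∈s x∈s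
    where
    t∈T = G⊆ₛT t∈G
    two≤ : ∀ {u : Simplex} → length u ≡ 3 → 2 ≤ length u
    two≤ |u| = subst (2 ≤_) (sym |u|) (s≤s (s≤s z≤n))

star⊆G⇒vertex∉piece : ∀ {T G X v} → (∀ {u} → u ∈ T → length u ≡ 3 → v ∈ u → u ∈ G) →
                      Subcomplex X T → Disc X → EmptyOrCircle (G ∩ X) →
                      ∀ {s} → s ∈ X → v ∉ s
star⊆G⇒vertex∉piece star⊆G X⊆T X-disc G∩X s∈X v∈s =
  let (u , u∈X , |u| , v⊆u) =
        Pure2.inTriangle (Disc.pure X-disc) (vertex∈ (Disc.complex X-disc) s∈X v∈s)
      u∈G∩X = ∈-∩⁺ (star⊆G (Subcomplex.sub X⊆T u∈X) |u| (to∈ v⊆u)) u∈X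
  in <-irrefl refl (subst (_≤ 2) |u| (emptyOrCircle⇒length≤2 G∩X u∈G∩X))

without : Simplex → Complex → Complex
without t = filter (λ s → ¬? (≡-dec _≟_ s t))

module _ {t : Simplex} {K : Complex} where

  ∈-without⁺ : ∀ {s} → s ∈ K → s ≢ t → s ∈ without t K
  ∈-without⁺ = ∈-filter⁺ (λ s → ¬? (≡-dec _≟_ s t))

  ∈-without⁻ : ∀ {s} → s ∈ without t K → s ∈ K × s ≢ t
  ∈-without⁻ = ∈-filter⁻ (λ s → ¬? (≡-dec _≟_ s t))

  without-unique : Unique K → Unique (without t K)
  without-unique = Unique.filter⁺ (λ s → ¬? (≡-dec _≟_ s t))

  without-complex : IsComplex K → (∀ {s} → s ∈ K → t ⊆ s → s ≡ t) → IsComplex (without t K)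
  without-complex K-complex t-facet = record
    { simplices  = All.tabulate (All.lookup (IsComplex.simplices K-complex) ∘ proj₁ ∘ ∈-without⁻)
    ; noDup      = without-unique (IsComplex.noDup K-complex)
    ; faceClosed = λ s∈ u⊆s |u|≥1 → let (s∈K , s≢t) = ∈-without⁻ s∈ in
        ∈-without⁺ (IsComplex.faceClosed K-complex s∈K u⊆s |u|≥1) λ { refl → s≢t (t-facet s∈K u⊆s) }
    }

  #triangles-without : Unique K → t ∈ K → length t ≡ 3 → #triangles (without t K) < #triangles K
  #triangles-without K-unique t∈K |t| = unique⇒length-<
    (Unique.filter⁺ (λ s → length s ≟ 3) (without-unique K-unique))
    (λ s∈ → let (s∈K∖t , |s|) = ∈-ofSize⁻ {3} {without t K} s∈
            in ∈-ofSize⁺ {3} {K} (proj₁ (∈-without⁻ s∈K∖t)) |s|)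
    (∈-ofSize⁺ {3} {K} t∈K |t|)
    (λ t∈ → proj₂ (∈-without⁻ (proj₁ (∈-ofSize⁻ {3} {without t K} t∈))) refl)

  without-∩ : ∀ {X} → t ∉ X → without t K ∩ X ≡ K ∩ X
  without-∩ {X} t∉X =
    filter-filter-⇒ (λ s → s ∈? X) (λ s → ¬? (≡-dec _≟_ s t)) (λ { s∈X refl → t∉X s∈X }) K

module TriangleClosure {a b c : ℕ} (a<b : a < b) (b<c : b < c) where

  t : Simplex
  t = a ∷ b ∷ c ∷ []

  Δ : Complex
  Δ = (a ∷ []) ∷ (b ∷ []) ∷ (c ∷ []) ∷ (a ∷ b ∷ []) ∷ (a ∷ c ∷ []) ∷ (b ∷ c ∷ []) ∷ t ∷ []

  t∈Δ : t ∈ Δ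
  t∈Δ = there (there (there (there (there (there (here refl))))))

  Δ-⊆ : ∀ {s} → s ∈ Δ → s ⊆ t
  Δ-⊆ (here refl)                                                 = refl ∷ b ∷ʳ c ∷ʳ []
  Δ-⊆ (there (here refl))                                         = a ∷ʳ refl ∷ c ∷ʳ []
  Δ-⊆ (there (there (here refl)))                                 = a ∷ʳ b ∷ʳ refl ∷ []
  Δ-⊆ (there (there (there (here refl))))                         = refl ∷ refl ∷ c ∷ʳ []
  Δ-⊆ (there (there (there (there (here refl)))))                 = refl ∷ b ∷ʳ refl ∷ []
  Δ-⊆ (there (there (there (there (there (here refl))))))         = a ∷ʳ refl ∷ refl ∷ []
  Δ-⊆ (there (there (there (there (there (there (here refl))))))) = refl ∷ refl ∷ refl ∷ []

  face∈Δ : ∀ {s} → s ⊆ t → 1 ≤ length s → s ∈ Δ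
  face∈Δ (_ ∷ʳ _ ∷ʳ _ ∷ʳ [])       ()
  face∈Δ (refl ∷ _ ∷ʳ _ ∷ʳ [])     _ = here refl
  face∈Δ (_ ∷ʳ refl ∷ _ ∷ʳ [])     _ = there (here refl)
  face∈Δ (_ ∷ʳ _ ∷ʳ refl ∷ [])     _ = there (there (here refl))
  face∈Δ (refl ∷ refl ∷ _ ∷ʳ [])   _ = there (there (there (here refl)))
  face∈Δ (refl ∷ _ ∷ʳ refl ∷ [])   _ = there (there (there (there (here refl))))
  face∈Δ (_ ∷ʳ refl ∷ refl ∷ [])   _ = there (there (there (there (there (here refl)))))
  face∈Δ (refl ∷ refl ∷ refl ∷ []) _ = t∈Δ

  a≢b : a ≢ b
  a≢b = <⇒≢ a<b

  b≢c : b ≢ c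
  b≢c = <⇒≢ b<c

  a≢c : a ≢ c
  a≢c = <⇒≢ (<-trans a<b b<c)

  Δ-unique : Unique Δ
  Δ-unique =
      (a≢b ∘ ∷-injectiveˡ ∷ a≢c ∘ ∷-injectiveˡ ∷ (λ ()) ∷ (λ ()) ∷ (λ ()) ∷ (λ ()) ∷ [])
    ∷ (b≢c ∘ ∷-injectiveˡ ∷ (λ ()) ∷ (λ ()) ∷ (λ ()) ∷ (λ ()) ∷ [])
    ∷ ((λ ()) ∷ (λ ()) ∷ (λ ()) ∷ (λ ()) ∷ [])
    ∷ (b≢c ∘ ∷-injectiveˡ ∘ ∷-injectiveʳ ∷ a≢b ∘ ∷-injectiveˡ ∷ (λ ()) ∷ [])
    ∷ (a≢b ∘ ∷-injectiveˡ ∷ (λ ()) ∷ [])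
    ∷ ((λ ()) ∷ [])
    ∷ [] ∷ []

  Δ-complex : IsComplex Δ
  Δ-complex = record
    { simplices  = ([-] , s≤s z≤n) ∷ ([-] , s≤s z≤n) ∷ ([-] , s≤s z≤n)
                 ∷ (a<b ∷ [-] , s≤s z≤n) ∷ (<-trans a<b b<c ∷ [-] , s≤s z≤n) ∷ (b<c ∷ [-] , s≤s z≤n)
                 ∷ (a<b ∷ b<c ∷ [-] , s≤s z≤n) ∷ []
    ; noDup      = Δ-unique
    ; faceClosed = λ s∈Δ u⊆s → face∈Δ (⊆-trans u⊆s (Δ-⊆ s∈Δ))
    }

  vertex∈t : ∀ {s v} → s ∈ Δ → v ∈ s → v ∈ t
  vertex∈t s∈Δ = lookup (Δ-⊆ s∈Δ)

  meets-t : ∀ {s} → s ∈ Δ → ∃[ v ] (v ∈ s × v ∈ t)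
  meets-t {s} s∈Δ with All.lookup (IsComplex.simplices Δ-complex) s∈Δ
  meets-t {[]}    _   | _ , ()
  meets-t {v ∷ _} s∈Δ | _     = v , here refl , vertex∈t s∈Δ (here refl)

  proper-face-length : ∀ {s} → s ∈ Δ → s ≢ t → length s ≤ 2
  proper-face-length {s} s∈Δ s≢t with length s ≤? 2
  ... | yes |s|≤2 = |s|≤2
  ... | no  |s|≰2 = contradiction (⊆∧length-≥⇒≡ (Δ-⊆ s∈Δ) (≰⇒> |s|≰2)) s≢t

  connect : ∀ {R : ℕ → ℕ → Set} → (∀ {u w} → u ∈ t → w ∈ t → u ≢ w → R u w) →
            ∀ {u w} → u ∈ t → w ∈ t → Star R u w
  connect R-distinct {u} {w} u∈t w∈t with u ≟ w
  ... | yes refl = ε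
  ... | no u≢w   = R-distinct u∈t w∈t u≢w ◅ ε

  edge∈Δ : ∀ {u w} → u ∈ t → w ∈ t → (e : Edge u w) → Edge.simplex e ∈ Δ
  edge∈Δ = edge∈ Δ-complex t∈Δ

  Δ-boundaryEdge : ∀ {e} → e ∈ Δ → length e ≡ 2 → BoundaryEdge Δ e
  Δ-boundaryEdge {e} e∈Δ |e| = e∈Δ , |e| , cong length (filter-accept (e ⊆?_) (Δ-⊆ e∈Δ))

  Δ-disc : Disc Δ
  Δ-disc = record
    { complex           = Δ-complex
    ; nonempty          = λ ()
    ; pure              = record
      { dimLe2     = All.tabulate (length-mono-≤ ∘ Δ-⊆)
      ; inTriangle = λ s∈Δ → t , t∈Δ , refl , Δ-⊆ s∈Δ }
    ; connected         = λ _ _ u∈Δ w∈Δ →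
        connect (adjacent Δ-complex t∈Δ) (vertex∈t u∈Δ (here refl)) (vertex∈t w∈Δ (here refl))
    ; edgeOneTwo        = λ e∈Δ |e| → inj₁ (proj₂ (proj₂ (Δ-boundaryEdge e∈Δ |e|)))
    ; linkConn          = λ _ v∈Δ _ _ → link-connected (vertex∈t v∈Δ (here refl))
    ; hasBoundary       =
        a , (a ∷ b ∷ []) , Δ-boundaryEdge (there (there (there (here refl)))) refl , here refl
    ; boundaryConnected = λ _ _ (_ , (e∈Δ , _) , u∈e) (_ , (f∈Δ , _) , w∈f) →
        connect (λ u∈t w∈t u≢w → let e = edge u≢w in
                  u≢w , Edge.simplex e , Δ-boundaryEdge (edge∈Δ u∈t w∈t e) (Edge.size e) ,
                  Edge.∋ˡ e , Edge.∋ʳ e)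
                (vertex∈t e∈Δ u∈e) (vertex∈t f∈Δ w∈f)
    ; euler             = refl
    }
    where
    link-connected : ∀ {v x y} → v ∈ t → Adj Δ v x → Adj Δ v y → Star (LinkAdj Δ v) x y
    link-connected {v} {x} {y} v∈t (v≢x , _ , e∈Δ , _ , _ , x∈e) (v≢y , _ , f∈Δ , _ , _ , y∈f)
      with x ≟ y
    ... | yes refl = ε
    ... | no x≢y   =
      (x≢y , v≢x , v≢y , t , t∈Δ , refl , v∈t , vertex∈t e∈Δ x∈e , vertex∈t f∈Δ y∈f) ◅ ε

  ∉-pair : ∀ {v x y : ℕ} → v ≢ x → v ≢ y → v ∉ x ∷ y ∷ []
  ∉-pair v≢x _ (here v≡x)         = v≢x v≡x
  ∉-pair _ v≢y (there (here v≡y)) = v≢y v≡y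

  module _ {v : ℕ} {ss ys : List Simplex} (s : Simplex) where

    accept : v ∈ s → filter ((v ∷ []) ⊆?_) ss ≡ ys → filter ((v ∷ []) ⊆?_) (s ∷ ss) ≡ s ∷ ys
    accept v∈s rest = trans (filter-accept ((v ∷ []) ⊆?_) (from∈ v∈s)) (cong (s ∷_) rest)

    reject : v ∉ s → filter ((v ∷ []) ⊆?_) ss ≡ ys → filter ((v ∷ []) ⊆?_) (s ∷ ss) ≡ ys
    reject v∉s rest = trans (filter-reject ((v ∷ []) ⊆?_) (v∉s ∘ to∈)) rest

  Δ-degree : ∀ {v} → v ∈ t → cofaceCount 2 Δ (v ∷ []) ≡ 2
  Δ-degree (here refl) = cong length
    (accept (a ∷ b ∷ []) (here refl)
      (accept (a ∷ c ∷ []) (here refl)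
        (reject (b ∷ c ∷ []) (∉-pair a≢b a≢c) refl)))
  Δ-degree (there (here refl)) = cong length
    (accept (a ∷ b ∷ []) (there (here refl))
      (reject (a ∷ c ∷ []) (∉-pair (≢-sym a≢b) b≢c)
        (accept (b ∷ c ∷ []) (here refl) refl)))
  Δ-degree (there (there (here refl))) = cong length
    (reject (a ∷ b ∷ []) (∉-pair (≢-sym a≢c) (≢-sym b≢c))
      (accept (a ∷ c ∷ []) (there (here refl))
        (accept (b ∷ c ∷ []) (there (here refl)) refl)))

  module ProperFaces {C : Complex} (C-unique : Unique C)
                     (C⊆Δ : ∀ {s} → s ∈ C → s ∈ Δ × s ≢ t)
                     (Δ⊆C : ∀ {s} → s ∈ Δ → s ≢ t → s ∈ C) where

    length≤2⇒≢t : ∀ {s : Simplex} → length s ≤ 2 → s ≢ t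
    length≤2⇒≢t |s|≤2 refl = <-irrefl refl |s|≤2

    vertex∈C⇒∈t : ∀ {s v} → s ∈ C → v ∈ s → v ∈ t
    vertex∈C⇒∈t = vertex∈t ∘ proj₁ ∘ C⊆Δ

    degree : ∀ {v} → v ∈ t → cofaceCount 2 C (v ∷ []) ≡ 2
    degree v∈t = trans
      (≤-antisym (cofaceCount-≤ C-unique λ s∈C _ _ → proj₁ (C⊆Δ s∈C))
                 (cofaceCount-≤ Δ-unique λ s∈Δ |s| _ →
                    Δ⊆C s∈Δ (length≤2⇒≢t (subst (_≤ 2) (sym |s|) ≤-refl))))
      (Δ-degree v∈t)

    circle : Circle C
    circle = record
      { complex   = record
        { simplices  = All.tabulate (All.lookup (IsComplex.simplices Δ-complex) ∘ proj₁ ∘ C⊆Δ)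
        ; noDup      = C-unique
        ; faceClosed = λ s∈C u⊆s |u|≥1 → let (s∈Δ , s≢t) = C⊆Δ s∈C in
            Δ⊆C (IsComplex.faceClosed Δ-complex s∈Δ u⊆s |u|≥1)
                (length≤2⇒≢t (≤-trans (length-mono-≤ u⊆s) (proper-face-length s∈Δ s≢t)))
        }
      ; nonempty  = λ { refl → case Δ⊆C (here refl) (length≤2⇒≢t (s≤s z≤n)) of λ () }
      ; dimLe1    = All.tabulate λ s∈C → let (s∈Δ , s≢t) = C⊆Δ s∈C in proper-face-length s∈Δ s≢t
      ; connected = λ _ _ u∈C w∈C → connect
          (λ u∈t w∈t u≢w → let e = edge u≢w in
             u≢w , Edge.simplex e ,
             Δ⊆C (edge∈Δ u∈t w∈t e) (length≤2⇒≢t (subst (_≤ 2) (sym (Edge.size e)) ≤-refl)) ,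
             Edge.size e , Edge.∋ˡ e , Edge.∋ʳ e)
          (vertex∈C⇒∈t u∈C (here refl)) (vertex∈C⇒∈t w∈C (here refl))
      ; degTwo    = λ _ v∈C → degree (vertex∈C⇒∈t v∈C (here refl))
      }

module Refinement {T} (surface : ClosedSurface T) (d : Decomposition T)
                  {a b c : ℕ} (a<b : a < b) (b<c : b < c)
                  (t∈G : (a ∷ b ∷ c ∷ []) ∈ Decomposition.G d)
                  (interior : ∀ {v} → v ∈ a ∷ b ∷ c ∷ [] → ¬ BoundaryVertex (Decomposition.G d) v)
                  where
  open Decomposition d
  open TriangleClosure a<b b<c
  open InteriorStar surface G-sub using (interior⇒star⊆G)
  open Subcomplex G-sub renaming (complex to G-complex; sub to G⊆T)

  Piece : Complex → Set
  Piece X = Subcomplex X T × Disc X × EmptyOrCircle (G ∩ X)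

  D-piece : Piece D
  D-piece = D-sub , D-disc , GD

  Ds-piece : ∀ i → Piece (Ds i)
  Ds-piece i = Ds-sub i , Ds-disc i , GDi i

  piece∉Δ : ∀ {X} → Piece X → ∀ {s} → s ∈ X → s ∉ Δ
  piece∉Δ (X⊆T , X-disc , G∩X) s∈X s∈Δ =
    let (v , v∈s , v∈t) = meets-t s∈Δ
    in star⊆G⇒vertex∉piece (interior⇒star⊆G t∈G refl v∈t (interior v∈t)) X⊆T X-disc G∩X s∈X v∈s

  Δ⊆G : ∀ {s} → s ∈ Δ → s ∈ G
  Δ⊆G s∈Δ = IsComplex.faceClosed G-complex t∈G (Δ-⊆ s∈Δ)
              (proj₂ (All.lookup (IsComplex.simplices Δ-complex) s∈Δ))

  t-facet : ∀ {s} → s ∈ G → t ⊆ s → s ≡ t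
  t-facet s∈G t⊆s =
    sym (⊆∧length-≥⇒≡ t⊆s (All.lookup (Pure2.dimLe2 (ClosedSurface.pure surface)) (G⊆T s∈G)))

  G′ : Complex
  G′ = without t G

  G′-complex : IsComplex G′
  G′-complex = without-complex G-complex t-facet

  G′∩Δ-circle : Circle (G′ ∩ Δ)
  G′∩Δ-circle = ProperFaces.circle
    (Unique.filter⁺ (λ s → s ∈? Δ) (IsComplex.noDup G′-complex))
    (λ s∈ → let (s∈G′ , s∈Δ) = ∈-∩⁻ {G′} s∈ in s∈Δ , proj₂ (∈-without⁻ {K = G} s∈G′))
    (λ s∈Δ s≢t → ∈-∩⁺ {G′} (∈-without⁺ {K = G} (Δ⊆G s∈Δ) s≢t) s∈Δ)

  G′∩piece : ∀ {X} → Piece X → EmptyOrCircle (G′ ∩ X)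
  G′∩piece piece@(_ , _ , G∩X) =
    subst EmptyOrCircle (sym (without-∩ {K = G} λ t∈X → piece∉Δ piece t∈X t∈Δ)) G∩X

  Ds′ : Fin (suc n) → Complex
  Ds′ zero    = Δ
  Ds′ (suc i) = Ds i

  Ds′-sub : ∀ i → Subcomplex (Ds′ i) T
  Ds′-sub zero    = record { complex = Δ-complex ; sub = G⊆T ∘ Δ⊆G }
  Ds′-sub (suc i) = Ds-sub i

  Ds′-disc : ∀ i → Disc (Ds′ i)
  Ds′-disc zero    = Δ-disc
  Ds′-disc (suc i) = Ds-disc i

  cover′ : ∀ {s} → s ∈ T → s ∈ G′ ⊎ s ∈ D ⊎ ∃[ i ] (s ∈ Ds′ i)
  cover′ {s} s∈T with cover s∈T
  ... | inj₂ (inj₁ s∈D)        = inj₂ (inj₁ s∈D)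
  ... | inj₂ (inj₂ (i , s∈Di)) = inj₂ (inj₂ (suc i , s∈Di))
  ... | inj₁ s∈G with ≡-dec _≟_ s t
  ...   | yes refl = inj₂ (inj₂ (zero , t∈Δ))
  ...   | no s≢t   = inj₁ (∈-without⁺ s∈G s≢t)

  G′∩Ds′ : ∀ i → EmptyOrCircle (G′ ∩ Ds′ i)
  G′∩Ds′ zero    = inj₂ G′∩Δ-circle
  G′∩Ds′ (suc i) = G′∩piece (Ds-piece i)

  D∩Ds′ : ∀ i → EmptyOrCircle (D ∩ Ds′ i)
  D∩Ds′ zero    = inj₁ (disjoint⇒∩≡[] (piece∉Δ D-piece))
  D∩Ds′ (suc i) = DDi i

  Ds′∩Ds′ : ∀ i j → i ≢ j → EmptyOrCircle (Ds′ i ∩ Ds′ j)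
  Ds′∩Ds′ zero    zero    i≢j = contradiction refl i≢j
  Ds′∩Ds′ zero    (suc j) _   = inj₁ (disjoint⇒∩≡[] λ s∈Δ s∈Dj → piece∉Δ (Ds-piece j) s∈Dj s∈Δ)
  Ds′∩Ds′ (suc i) zero    _   = inj₁ (disjoint⇒∩≡[] (piece∉Δ (Ds-piece i)))
  Ds′∩Ds′ (suc i) (suc j) i≢j = DiDj i j (i≢j ∘ cong suc)

  refined : Decomposition T
  refined = record
    { G = G′ ; D = D ; n = suc n ; Ds = Ds′
    ; G-sub = record { complex = G′-complex ; sub = G⊆T ∘ proj₁ ∘ ∈-without⁻ }
    ; D-sub = D-sub ; Ds-sub = Ds′-sub ; D-disc = D-disc ; Ds-disc = Ds′-disc
    ; D-maxVertex = D-maxVertex ; cover = cover′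
    ; GD = G′∩piece D-piece ; GDi = G′∩Ds′ ; DDi = D∩Ds′ ; DiDj = Ds′∩Ds′
    }

  fewer-triangles : #triangles G′ < #triangles G
  fewer-triangles = #triangles-without (IsComplex.noDup G-complex) t∈G refl

interior-triangle⇒¬minimal :
  ∀ {T} → ClosedSurface T → (d : Decomposition T) → ∀ {t} → t ∈ triangles (Decomposition.G d) →
  (∀ {v} → v ∈ t → ¬ BoundaryVertex (Decomposition.G d) v) → ¬ MinimalDecomposition T d
interior-triangle⇒¬minimal surface d t∈ interior minimal with ∈-ofSize⁻ t∈
... | t∈G , |t| with sorted (Subcomplex.complex (Decomposition.G-sub d)) t∈G
interior-triangle⇒¬minimal surface d _ interior minimal | t∈G , refl | a<b ∷ b<c ∷ [-] =
  <-irrefl refl (≤-trans fewer-triangles (minimal refined))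
  where open Refinement surface d a<b b<c t∈G interior

boundaryVertex? : ∀ K v → Dec (BoundaryVertex K v)
boundaryVertex? K v
  with Any.any? (λ e → ((length e ≟ 2) ×-dec (cofaceCount 3 K e ≟ 1)) ×-dec (v ∈ℕ? e)) K
... | yes found = let (e , e∈K , (|e| , #e) , v∈e) = find found in yes (e , (e∈K , |e| , #e) , v∈e)
... | no ∄e     = no λ { (e , (e∈K , |e| , #e) , v∈e) → ∄e (lose e∈K ((|e| , #e) , v∈e)) }

proposition2p12 : (T : Complex) → ClosedSurface T →
                  (d : Decomposition T) → MinimalDecomposition T d →
                  ∀ t → t ∈ triangles (Decomposition.G d) →
                  MeetsBoundary (Decomposition.G d) t
proposition2p12 T surface d minimal t t∈ with Any.any? (boundaryVertex? (Decomposition.G d)) t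
... | yes meets = find meets
... | no ¬meets = contradiction minimal
      (interior-triangle⇒¬minimal surface d t∈ λ v∈t v∈∂G → ¬meets (lose v∈t v∈∂G))
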